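{- Let $f:\{0,1\}^n\to\{0,1\}$ with $F:=f^{ -1}(1)\neq\emptyset$, define $g_f(a)=1$ iff $\Pr_{x\sim F}[f(a\oplus x)=1]\ge 1/2$, and let $G:=g_f^{ -1}(1)$. Let $\mathcal{X}=\{x\in G:\{y\in\{0,1\}^n: y\preceq x\}\subseteq G\}$. If $G$ is a linear subspace of $\mathbb{F}_2^n$, then $\mathcal{X}$ is a linear subspace contained in $G$. Moreover, if in addition $g_f$ is not an anti-monotone conjunction, then $|\mathcal{X}|\le|G|/2$.
   Context: $\{0,1\}^n$ is identified with $\mathbb{F}_2^n$ with addition $\oplus$ (coordinatewise XOR). $y\preceq x$ means $y_i\le x_i$ for all $i$. $x\sim F$ is uniform on $F$. An anti-monotone conjunction is a conjunction of negated variables. -}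

module Defs where

open import Data.Bool using (Bool; true; false; _∧_; _xor_; if_then_else_)
open import Data.Nat using (ℕ; zero; suc; _≤_; _*_; _≤ᵇ_)
open import Data.List using (List; []; _∷_; _++_; map)
open import Data.Vec using (Vec; []; _∷_; zipWith; lookup)
open import Data.Fin using (Fin)
open import Data.Product using (Σ; _×_)
open import Function.Bundles using (_⇔_)
open import Relation.Binary.PropositionalEquality using (_≡_)

Cube : ℕ → Set
Cube n = Vec Bool n

_⊕_ : ∀ {n} → Cube n → Cube n → Cube n
_⊕_ = zipWith _xor_

zeroVec : ∀ n → Cube n
zeroVec zero = []
zeroVec (suc n) = false ∷ zeroVec n

allVecs : ∀ n → List (Cube n)
allVecs zero = [] ∷ []
allVecs (suc n) = map (false ∷_) (allVecs n) ++ map (true ∷_) (allVecs n)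

countL : ∀ {A : Set} → (A → Bool) → List A → ℕ
countL p [] = 0
countL p (x ∷ xs) = if p x then suc (countL p xs) else countL p xs

card : ∀ {n} → (Cube n → Bool) → ℕ
card {n} p = countL p (allVecs n)

-- g_f(a) = 1 iff Pr_{x ~ F}[f(a ⊕ x) = 1] ≥ 1/2, i.e.
-- |F| ≤ 2 · |{x ∈ F : f(a ⊕ x) = 1}|
g : ∀ {n} → (Cube n → Bool) → Cube n → Bool
g f a = card f ≤ᵇ 2 * card (λ x → f x ∧ f (a ⊕ x))

_⪯_ : ∀ {n} → Cube n → Cube n → Set
y ⪯ x = ∀ i → lookup y i ≡ true → lookup x i ≡ true

IsSubspace : ∀ {n} → (Cube n → Bool) → Set
IsSubspace {n} S =
  (S (zeroVec n) ≡ true) ×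
  (∀ a b → S a ≡ true → S b ≡ true → S (a ⊕ b) ≡ true)

InX : ∀ {n} → (Cube n → Bool) → Cube n → Set
InX G x = (G x ≡ true) × (∀ y → y ⪯ x → G y ≡ true)

-- h is an anti-monotone conjunction: h(x) = ⋀_{i ∈ S} ¬x_i for some
-- S ⊆ [n] (given as a mask; the empty conjunction, constant 1, is allowed)
IsAntiMonotoneConj : ∀ {n} → (Cube n → Bool) → Set
IsAntiMonotoneConj {n} h =
  Σ (Cube n) λ S → ∀ x →
    (h x ≡ true) ⇔ (∀ i → lookup S i ≡ true → lookup x i ≡ false)

-- Nothing about f is used beyond G := g_f⁻¹(1) being a subspace. Such a G
-- contains every vector supported on S := {i : eᵢ ∈ G} (it is spanned by those
-- eᵢ), and conversely every x ∈ 𝒳 lies in that set, since eᵢ ⪯ x whenever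
-- xᵢ = 1. So 𝒳 is the coordinate subspace of vectors supported on S, which is
-- an anti-monotone conjunction (of ¬xᵢ for i ∉ S). If G ≠ 𝒳, pick z ∈ G ∖ 𝒳:
-- then 𝒳 and its translate 𝒳 ⊕ z are disjoint subsets of G of equal size.
module Submission where

open import Defs
open import Data.Bool using (Bool; true; false; _∧_; _xor_; not)
open import Data.Bool.Properties using (∧-conicalˡ; ∧-conicalʳ) renaming (_≟_ to _≟ᵇ_)
open import Data.Nat using (ℕ; zero; suc; _≤_; _*_; _+_; z≤n; s≤s)
open import Data.Nat.Properties using (+-suc; +-comm; +-identityʳ; m≤n⇒m≤1+n)
open import Data.Fin using (Fin) renaming (zero to fzero; suc to fsuc)
open import Data.List using ([]; _∷_; _++_; map)
open import Data.Vec using ([]; _∷_; lookup; tabulate)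
open import Data.Vec.Properties using (lookup-zipWith; lookup∘tabulate)
open import Data.Product using (Σ; _×_; _,_)
open import Data.Sum using (_⊎_; inj₁; inj₂)
open import Data.Empty using (⊥; ⊥-elim)
open import Function using (_∘_)
open import Function.Bundles using (mk⇔; Equivalence)
open import Relation.Nullary using (¬_; Dec; yes; no; _×-dec_)
open import Relation.Binary.PropositionalEquality
  using (_≡_; refl; sym; trans; cong; cong₂; subst; module ≡-Reasoning)

private
  variable
    n : ℕ

countL-++ : ∀ {A : Set} (p : A → Bool) xs ys →
            countL p (xs ++ ys) ≡ countL p xs + countL p ys
countL-++ p []       ys = refl
countL-++ p (x ∷ xs) ys with p x
... | true  = cong suc (countL-++ p xs ys)
... | false = countL-++ p xs ys

countL-map : ∀ {A B : Set} (p : B → Bool) (h : A → B) xs →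
             countL p (map h xs) ≡ countL (p ∘ h) xs
countL-map p h []       = refl
countL-map p h (x ∷ xs) with p (h x)
... | true  = cong suc (countL-map p h xs)
... | false = countL-map p h xs

countL-disjoint-+-≤ : ∀ {A : Set} (p q r : A → Bool) →
                      (∀ x → p x ≡ true → q x ≡ true → ⊥) →
                      (∀ x → p x ≡ true → r x ≡ true) →
                      (∀ x → q x ≡ true → r x ≡ true) →
                      ∀ xs → countL p xs + countL q xs ≤ countL r xs
countL-disjoint-+-≤ p q r disj p⊆r q⊆r [] = z≤n
countL-disjoint-+-≤ p q r disj p⊆r q⊆r (x ∷ xs)
  with p x in px | q x in qx | r x in rx
     | countL-disjoint-+-≤ p q r disj p⊆r q⊆r xs
... | true  | true  | _     | _  = ⊥-elim (disj x px qx)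
... | true  | false | true  | ih = s≤s ih
... | true  | false | false | _  with () ← trans (sym (p⊆r x px)) rx
... | false | true  | true  | ih =
  subst (_≤ suc (countL r xs)) (sym (+-suc (countL p xs) (countL q xs))) (s≤s ih)
... | false | true  | false | _  with () ← trans (sym (q⊆r x qx)) rx
... | false | false | true  | ih = m≤n⇒m≤1+n ih
... | false | false | false | ih = ih

card-suc : (p : Cube (suc n) → Bool) →
           card p ≡ card (p ∘ (false ∷_)) + card (p ∘ (true ∷_))
card-suc {n} p =
  trans (countL-++ p (map (false ∷_) (allVecs n)) (map (true ∷_) (allVecs n)))
        (cong₂ _+_ (countL-map p (false ∷_) (allVecs n))
                   (countL-map p (true ∷_) (allVecs n)))

card-translate : (p : Cube n → Bool) (z : Cube n) → card (λ x → p (x ⊕ z)) ≡ card p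
card-translate p [] = refl
card-translate p (b ∷ z) = begin
  card (λ x → p (x ⊕ (b ∷ z)))
    ≡⟨ card-suc (λ x → p (x ⊕ (b ∷ z))) ⟩
  card (λ x → p ((false xor b) ∷ (x ⊕ z))) + card (λ x → p ((true xor b) ∷ (x ⊕ z)))
    ≡⟨ cong₂ _+_ (card-translate (p ∘ ((false xor b) ∷_)) z)
                 (card-translate (p ∘ ((true xor b) ∷_)) z) ⟩
  card (p ∘ ((false xor b) ∷_)) + card (p ∘ ((true xor b) ∷_))
    ≡⟨ flip b ⟩
  card (p ∘ (false ∷_)) + card (p ∘ (true ∷_))
    ≡⟨ sym (card-suc p) ⟩
  card p ∎
  where
  open ≡-Reasoning
  flip : ∀ b → card (p ∘ ((false xor b) ∷_)) + card (p ∘ ((true xor b) ∷_))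
             ≡ card (p ∘ (false ∷_)) + card (p ∘ (true ∷_))
  flip false = refl
  flip true  = +-comm (card (p ∘ (true ∷_))) (card (p ∘ (false ∷_)))

search : (P : Cube n → Set) → (∀ z → Dec (P z)) → Σ (Cube n) P ⊎ (∀ z → ¬ P z)
search {zero} P P? with P? []
... | yes p  = inj₁ ([] , p)
... | no ¬p  = inj₂ λ { [] → ¬p }
search {suc n} P P? with search (P ∘ (false ∷_)) (P? ∘ (false ∷_))
                       | search (P ∘ (true ∷_)) (P? ∘ (true ∷_))
... | inj₁ (z , p) | _            = inj₁ (false ∷ z , p)
... | inj₂ _       | inj₁ (z , p) = inj₁ (true ∷ z , p)
... | inj₂ ¬p₀     | inj₂ ¬p₁     = inj₂ λ { (false ∷ z) → ¬p₀ z ; (true ∷ z) → ¬p₁ z }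

≡true-ext : ∀ {A : Set} {p q : A → Bool} → (∀ x → p x ≡ true → q x ≡ true) →
            (∀ x → q x ≡ true → p x ≡ true) → ∀ x → p x ≡ q x
≡true-ext {p = p} {q} p⊆q q⊆p x with p x in px | q x in qx
... | true  | _     = trans (sym (p⊆q x px)) qx
... | false | false = refl
... | false | true  = trans (sym px) (q⊆p x qx)

lookup-⊕ : (a b : Cube n) (i : Fin n) → lookup (a ⊕ b) i ≡ lookup a i xor lookup b i
lookup-⊕ a b i = lookup-zipWith _xor_ i a b

lookup-zeroVec : (i : Fin n) → lookup (zeroVec n) i ≡ false
lookup-zeroVec fzero    = refl
lookup-zeroVec (fsuc i) = lookup-zeroVec i

⊕-identityˡ : (x : Cube n) → zeroVec n ⊕ x ≡ x
⊕-identityˡ []      = refl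
⊕-identityˡ (b ∷ x) = cong (b ∷_) (⊕-identityˡ x)

⊕-cancelʳ : (x z : Cube n) → (x ⊕ z) ⊕ z ≡ x
⊕-cancelʳ []      []      = refl
⊕-cancelʳ (a ∷ x) (b ∷ z) = cong₂ _∷_ (xor-cancelʳ a b) (⊕-cancelʳ x z)
  where
  xor-cancelʳ : ∀ a b → (a xor b) xor b ≡ a
  xor-cancelʳ true  true  = refl
  xor-cancelʳ true  false = refl
  xor-cancelʳ false true  = refl
  xor-cancelʳ false false = refl

⊕-cancelˡ : (x z : Cube n) → x ⊕ (x ⊕ z) ≡ z
⊕-cancelˡ []      []      = refl
⊕-cancelˡ (a ∷ x) (b ∷ z) = cong₂ _∷_ (xor-cancelˡ a b) (⊕-cancelˡ x z)
  where
  xor-cancelˡ : ∀ a b → a xor (a xor b) ≡ b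
  xor-cancelˡ true  true  = refl
  xor-cancelˡ true  false = refl
  xor-cancelˡ false _     = refl

subspace-restrict : {P : Cube (suc n) → Bool} → IsSubspace P → IsSubspace (P ∘ (false ∷_))
subspace-restrict (P0 , P⊕) = P0 , λ a b → P⊕ (false ∷ a) (false ∷ b)

unit : Fin n → Cube n
unit {suc n} fzero = true ∷ zeroVec n
unit (fsuc i)      = false ∷ unit i

unit-⪯ : (x : Cube n) (i : Fin n) → lookup x i ≡ true → unit i ⪯ x
unit-⪯ (_ ∷ x) fzero    xᵢ fzero    _  = xᵢ
unit-⪯ (_ ∷ x) fzero    xᵢ (fsuc j) eⱼ with () ← trans (sym eⱼ) (lookup-zeroVec j)
unit-⪯ (_ ∷ x) (fsuc i) xᵢ (fsuc j) eⱼ = unit-⪯ x i xᵢ j eⱼ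

supportedIn : (Fin n → Bool) → Cube n → Bool
supportedIn s []          = true
supportedIn s (false ∷ x) = supportedIn (s ∘ fsuc) x
supportedIn s (true ∷ x)  = s fzero ∧ supportedIn (s ∘ fsuc) x

supportedIn-sound : (s : Fin n → Bool) (x : Cube n) → supportedIn s x ≡ true →
                    ∀ i → lookup x i ≡ true → s i ≡ true
supportedIn-sound s (false ∷ x) h (fsuc i) xᵢ = supportedIn-sound (s ∘ fsuc) x h i xᵢ
supportedIn-sound s (true ∷ x)  h fzero    _  = ∧-conicalˡ (s fzero) _ h
supportedIn-sound s (true ∷ x)  h (fsuc i) xᵢ =
  supportedIn-sound (s ∘ fsuc) x (∧-conicalʳ (s fzero) _ h) i xᵢ

supportedIn-complete : (s : Fin n → Bool) (x : Cube n) →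
                       (∀ i → lookup x i ≡ true → s i ≡ true) → supportedIn s x ≡ true
supportedIn-complete s []          h = refl
supportedIn-complete s (false ∷ x) h = supportedIn-complete (s ∘ fsuc) x (h ∘ fsuc)
supportedIn-complete s (true ∷ x)  h rewrite h fzero refl =
  supportedIn-complete (s ∘ fsuc) x (h ∘ fsuc)

supportedIn-isSubspace : (s : Fin n → Bool) → IsSubspace (supportedIn s)
supportedIn-isSubspace {n} s = zero∈ , ⊕∈
  where
  zero∈ : supportedIn s (zeroVec n) ≡ true
  zero∈ = supportedIn-complete s (zeroVec n) vacuous
    where
    vacuous : ∀ i → lookup (zeroVec n) i ≡ true → s i ≡ true
    vacuous i h with () ← trans (sym h) (lookup-zeroVec i)
  ⊕∈ : ∀ a b → supportedIn s a ≡ true → supportedIn s b ≡ true → supportedIn s (a ⊕ b) ≡ true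
  ⊕∈ a b sa sb = supportedIn-complete s (a ⊕ b) λ i h →
    either i (lookup a i) (lookup b i) refl refl (trans (sym (lookup-⊕ a b i)) h)
    where
    either : ∀ i u v → lookup a i ≡ u → lookup b i ≡ v → u xor v ≡ true → s i ≡ true
    either i true  _    aᵢ _  _ = supportedIn-sound s a sa i aᵢ
    either i false true _  bᵢ _ = supportedIn-sound s b sb i bᵢ

supportedIn-antiMonotoneConj : (s : Fin n → Bool) → IsAntiMonotoneConj (supportedIn s)
supportedIn-antiMonotoneConj s = mask , λ x → mk⇔ (to x) (from x)
  where
  mask : Cube _
  mask = tabulate (not ∘ s)
  to : ∀ x → supportedIn s x ≡ true → ∀ i → lookup mask i ≡ true → lookup x i ≡ false
  to x h i mᵢ with lookup x i in xᵢ | s i in sᵢ | trans (sym (lookup∘tabulate (not ∘ s) i)) mᵢ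
  ... | false | _     | _  = refl
  ... | true  | false | _  with () ← trans (sym (supportedIn-sound s x h i xᵢ)) sᵢ
  to x h i mᵢ | true | true | ()
  from : ∀ x → (∀ i → lookup mask i ≡ true → lookup x i ≡ false) → supportedIn s x ≡ true
  from x h = supportedIn-complete s x λ i xᵢ → go i xᵢ
    where
    go : ∀ i → lookup x i ≡ true → s i ≡ true
    go i xᵢ with s i in sᵢ
    ... | true  = refl
    ... | false with () ← trans (sym xᵢ)
                          (h i (trans (lookup∘tabulate (not ∘ s) i) (cong not sᵢ)))

IsAntiMonotoneConj-resp : {h h′ : Cube n → Bool} → (∀ x → h x ≡ h′ x) →
                          IsAntiMonotoneConj h → IsAntiMonotoneConj h′
IsAntiMonotoneConj-resp h≗h′ (S , amc) =
  S , λ x → mk⇔ (Equivalence.to (amc x) ∘ trans (h≗h′ x))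
                (trans (sym (h≗h′ x)) ∘ Equivalence.from (amc x))

subspace-contains-supported : {G : Cube n → Bool} → IsSubspace G →
                              ∀ y → (∀ i → lookup y i ≡ true → G (unit i) ≡ true) → G y ≡ true
subspace-contains-supported {zero}  (G0 , _) [] _ = G0
subspace-contains-supported {suc n} G-sub (false ∷ y) h =
  subspace-contains-supported (subspace-restrict G-sub) y (h ∘ fsuc)
subspace-contains-supported {suc n} {G} G-sub@(_ , G⊕) (true ∷ y) h =
  subst (λ w → G (true ∷ w) ≡ true) (⊕-identityˡ y)
    (G⊕ (unit fzero) (false ∷ y) (h fzero refl)
        (subspace-contains-supported (subspace-restrict G-sub) y (h ∘ fsuc)))

proper-subspace-card : {G X : Cube n → Bool} → IsSubspace G → IsSubspace X →
                       (∀ x → X x ≡ true → G x ≡ true) →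
                       (z : Cube n) → G z ≡ true → X z ≡ false →
                       2 * card X ≤ card G
proper-subspace-card {n} {G} {X} (_ , G⊕) (_ , X⊕) X⊆G z Gz Xz =
  subst (_≤ card G) (cong (card X +_) (sym (+-identityʳ (card X))))
    (subst (λ m → card X + m ≤ card G) (card-translate X z)
      (countL-disjoint-+-≤ X (λ x → X (x ⊕ z)) G disjoint X⊆G shifted⊆G (allVecs n)))
  where
  disjoint : ∀ x → X x ≡ true → X (x ⊕ z) ≡ true → ⊥
  disjoint x Xx Xx⊕z with () ←
    trans (sym (subst (λ w → X w ≡ true) (⊕-cancelˡ x z) (X⊕ x (x ⊕ z) Xx Xx⊕z))) Xz
  shifted⊆G : ∀ x → X (x ⊕ z) ≡ true → G x ≡ true
  shifted⊆G x Xx⊕z = subst (λ w → G w ≡ true) (⊕-cancelʳ x z) (G⊕ (x ⊕ z) z (X⊆G _ Xx⊕z) Gz)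

claim3p14 : ∀ (n : ℕ) (f : Cube n → Bool) →
    Σ (Cube n) (λ x → f x ≡ true) →
    IsSubspace (g f) →
    Σ (Cube n → Bool) (λ X →
    (∀ x → (X x ≡ true) → InX (g f) x) ×
    (∀ x → InX (g f) x → X x ≡ true) ×
    IsSubspace X ×
    (∀ x → X x ≡ true → g f x ≡ true) ×
    (¬ IsAntiMonotoneConj (g f) → 2 * card X ≤ card (g f)))
claim3p14 n f _ G-sub =
  X , X⊆𝒳 , 𝒳⊆X , supportedIn-isSubspace S , X⊆G , half
  where
  G : Cube n → Bool
  G = g f
  S : Fin n → Bool
  S = G ∘ unit
  X : Cube n → Bool
  X = supportedIn S
  X⊆G : ∀ x → X x ≡ true → G x ≡ true
  X⊆G x Xx = subspace-contains-supported G-sub x (supportedIn-sound S x Xx)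
  X⊆𝒳 : ∀ x → X x ≡ true → InX G x
  X⊆𝒳 x Xx = X⊆G x Xx , λ y y⪯x →
    subspace-contains-supported G-sub y λ i yᵢ → supportedIn-sound S x Xx i (y⪯x i yᵢ)
  𝒳⊆X : ∀ x → InX G x → X x ≡ true
  𝒳⊆X x (_ , ↓x⊆G) = supportedIn-complete S x λ i xᵢ → ↓x⊆G (unit i) (unit-⪯ x i xᵢ)
  half : ¬ IsAntiMonotoneConj G → 2 * card X ≤ card G
  half ¬amc with search (λ z → G z ≡ true × X z ≡ false) (λ z → (G z ≟ᵇ true) ×-dec (X z ≟ᵇ false))
  ... | inj₁ (z , Gz , Xz) =
    proper-subspace-card G-sub (supportedIn-isSubspace S) X⊆G z Gz Xz
  ... | inj₂ G∖X-empty =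
    ⊥-elim (¬amc (IsAntiMonotoneConj-resp (≡true-ext X⊆G G⊆X) (supportedIn-antiMonotoneConj S)))
    where
    G⊆X : ∀ x → G x ≡ true → X x ≡ true
    G⊆X x Gx with X x in Xx
    ... | true  = refl
    ... | false = ⊥-elim (G∖X-empty x (Gx , Xx))
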